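{- Consider the Lambek calculus allowing empty antecedents (connectives $\cdot,\backslash,/$) extended with one unary connective ${!}$ governed by the rules $({!}\to)$, $(\to{!})$ and the local contraction rule $(\mathrm{contr})$, and optionally also the rule $(\mathrm{weak})$. For each of these two systems (with or without $(\mathrm{weak})$), the cut rule is not admissible: there is a sequent derivable in the system extended with $(\mathrm{cut})$ that is not derivable in the system without $(\mathrm{cut})$.
   Context: Formulae are built from variables using $\cdot$, $\backslash$, $/$ and unary ${!}$. Sequents are $\Gamma\to C$ with $\Gamma$ a finite, possibly empty, sequence of formulae. The Lambek calculus allowing empty antecedents has the axiom $A\to A$ and the rules (premises / conclusion): $\Gamma_1,A,B,\Gamma_2\to C\ /\ \Gamma_1,A\cdot B,\Gamma_2\to C$; $\Gamma_1\to A$, $\Gamma_2\to B\ /\ \Gamma_1,\Gamma_2\to A\cdot B$; $\Pi\to A$, $\Gamma_1,B,\Gamma_2\to C\ /\ \Gamma_1,\Pi,A\backslash B,\Gamma_2\to C$; $A,\Pi\to B\ /\ \Pi\to A\backslash B$; $\Pi\to A$, $\Gamma_1,B,\Gamma_2\to C\ /\ \Gamma_1,B/A,\Pi,\Gamma_2\to C$; $\Pi,A\to B\ /\ \Pi\to B/A$. The modal rules are: $({!}\to)$ $\Gamma_1,A,\Gamma_2\to C\ /\ \Gamma_1,{!}A,\Gamma_2\to C$; $(\to{!})$ ${!}A_1,\dots,{!}A_n\to B\ /\ {!}A_1,\dots,{!}A_n\to{!}B$; $(\mathrm{contr})$ (local contraction) $\Gamma_1,{!}A,{!}A,\Gamma_2\to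 C\ /\ \Gamma_1,{!}A,\Gamma_2\to C$; $(\mathrm{weak})$ $\Gamma_1,\Gamma_2\to C\ /\ \Gamma_1,{!}A,\Gamma_2\to C$. The cut rule: $\Pi\to A$, $\Gamma_1,A,\Gamma_2\to C\ /\ \Gamma_1,\Pi,\Gamma_2\to C$. -}

module Defs where

open import Data.Nat using (ℕ)
open import Data.Bool using (Bool; true; false)
open import Data.List using (List; []; _∷_; _++_; map)
open import Relation.Binary.PropositionalEquality using (_≡_)

data Fm : Set where
  var  : ℕ → Fm
  _·_  : Fm → Fm → Fm
  _\\_ : Fm → Fm → Fm
  _//_ : Fm → Fm → Fm   -- B // A  is  B / A
  !_   : Fm → Fm

infixr 30 _·_
infixr 25 _\\_
infixl 25 _//_
infix 35 !_

-- Derivability of  Γ → C  in the Lambek calculus allowing empty antecedents,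
-- extended with (!→), (→!), local contraction (contr);
-- (weak) is present iff  w ≡ true;  (cut) is present iff  c ≡ true.
data _⊢[_,_]_ : List Fm → Bool → Bool → Fm → Set where
  ax     : ∀ {w c A} → (A ∷ []) ⊢[ w , c ] A
  ·L     : ∀ {w c Γ₁ Γ₂ A B C} →
           (Γ₁ ++ A ∷ B ∷ Γ₂) ⊢[ w , c ] C →
           (Γ₁ ++ (A · B) ∷ Γ₂) ⊢[ w , c ] C
  ·R     : ∀ {w c Γ₁ Γ₂ A B} →
           Γ₁ ⊢[ w , c ] A → Γ₂ ⊢[ w , c ] B →
           (Γ₁ ++ Γ₂) ⊢[ w , c ] (A · B)
  \\L    : ∀ {w c Π Γ₁ Γ₂ A B C} →
           Π ⊢[ w , c ] A → (Γ₁ ++ B ∷ Γ₂) ⊢[ w , c ] C →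
           (Γ₁ ++ Π ++ (A \\ B) ∷ Γ₂) ⊢[ w , c ] C
  \\R    : ∀ {w c Π A B} →
           (A ∷ Π) ⊢[ w , c ] B →
           Π ⊢[ w , c ] (A \\ B)
  //L    : ∀ {w c Π Γ₁ Γ₂ A B C} →
           Π ⊢[ w , c ] A → (Γ₁ ++ B ∷ Γ₂) ⊢[ w , c ] C →
           (Γ₁ ++ (B // A) ∷ Π ++ Γ₂) ⊢[ w , c ] C
  //R    : ∀ {w c Π A B} →
           (Π ++ A ∷ []) ⊢[ w , c ] B →
           Π ⊢[ w , c ] (B // A)
  !L     : ∀ {w c Γ₁ Γ₂ A C} →
           (Γ₁ ++ A ∷ Γ₂) ⊢[ w , c ] C →
           (Γ₁ ++ (! A) ∷ Γ₂) ⊢[ w , c ] C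
  -- antecedent of the form !A₁, …, !Aₙ  (n ≥ 0), given as  map !_ As
  !R     : ∀ {w c As B} →
           map !_ As ⊢[ w , c ] B →
           map !_ As ⊢[ w , c ] (! B)
  contr  : ∀ {w c Γ₁ Γ₂ A C} →
           (Γ₁ ++ (! A) ∷ (! A) ∷ Γ₂) ⊢[ w , c ] C →
           (Γ₁ ++ (! A) ∷ Γ₂) ⊢[ w , c ] C
  weak   : ∀ {w c Γ₁ Γ₂ A C} → w ≡ true →
           (Γ₁ ++ Γ₂) ⊢[ w , c ] C →
           (Γ₁ ++ (! A) ∷ Γ₂) ⊢[ w , c ] C
  cut    : ∀ {w c Π Γ₁ Γ₂ A C} → c ≡ true →
           Π ⊢[ w , c ] A → (Γ₁ ++ A ∷ Γ₂) ⊢[ w , c ] C →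
           (Γ₁ ++ Π ++ Γ₂) ⊢[ w , c ] C

-- Without cut, a derivation of Γ → C where Γ consists of banged variables
-- and C is built from variables by · and ! can only use ·R, !R, (!→) and the
-- structural rules, and these keep the variables of C, read left to right,
-- matched monotonically (with repetitions, from contraction) into Γ.  For
-- !p, !q → (!p · !q) · (!p · !q) the word p q p q does not match into p q,
-- whereas a cut on  !p, !q → !(!p · !q)  lets contraction copy the whole pair.
module Submission where

open import Defs
open import Data.Bool using (Bool; true; false)
open import Data.List using (List; []; _∷_; _++_)
open import Data.List.Relation.Unary.All using (All; []; _∷_; head)
open import Data.List.Relation.Unary.All.Properties using (++⁺; ++⁻; ++⁻ˡ; ++⁻ʳ)
open import Data.Nat using (ℕ)
open import Data.Product using (Σ; _×_; _,_)
open import Relation.Binary.PropositionalEquality using (_≡_; refl)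
open import Relation.Nullary using (¬_)

unbang : Fm → Fm
unbang (! A) = unbang A
unbang A     = A

Atomic : Fm → Set
Atomic A = Σ ℕ λ n → unbang A ≡ var n

data Positive : Fm → Set where
  var : ∀ {n} → Positive (var n)
  _·_ : ∀ {A B} → Positive A → Positive B → Positive (A · B)
  !_  : ∀ {A} → Positive A → Positive (! A)

yield : Fm → List Fm
yield (A · B) = yield A ++ yield B
yield (! A)   = yield A
yield A       = A ∷ []

yield-atomic : ∀ A → Atomic A → yield A ≡ unbang A ∷ []
yield-atomic (var _)  _       = refl
yield-atomic (_ \\ _) _       = refl
yield-atomic (_ // _) _       = refl
yield-atomic (! A)    a       = yield-atomic A a
yield-atomic (_ · _)  (_ , ())

-- xs ≼ Γ : xs is matched monotonically into unbang Γ; a position of Γ may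
-- be used several times in a row.
infix 4 _≼_
data _≼_ : List Fm → List Fm → Set where
  []   : ∀ {Γ} → [] ≼ Γ
  use  : ∀ {xs A Γ} → xs ≼ A ∷ Γ → unbang A ∷ xs ≼ A ∷ Γ
  skip : ∀ {xs A Γ} → xs ≼ Γ → xs ≼ A ∷ Γ

≼-skips : ∀ Γ {xs Δ} → xs ≼ Δ → xs ≼ Γ ++ Δ
≼-skips []      m = m
≼-skips (_ ∷ Γ) m = skip (≼-skips Γ m)

≼-++ : ∀ {xs ys Γ Δ} → xs ≼ Γ → ys ≼ Δ → xs ++ ys ≼ Γ ++ Δ
≼-++ {Γ = Γ} []  n = ≼-skips Γ n
≼-++ (use m)     n = use (≼-++ m n)
≼-++ (skip m)    n = skip (≼-++ m n)

≼-unbang : ∀ Γ₁ {Γ₂ xs A} → xs ≼ Γ₁ ++ A ∷ Γ₂ → xs ≼ Γ₁ ++ ! A ∷ Γ₂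
≼-unbang []       []       = []
≼-unbang []       (use m)  = use (≼-unbang [] m)
≼-unbang []       (skip m) = skip m
≼-unbang (_ ∷ Γ₁) []       = []
≼-unbang (_ ∷ Γ₁) (use m)  = use (≼-unbang (_ ∷ Γ₁) m)
≼-unbang (_ ∷ Γ₁) (skip m) = skip (≼-unbang Γ₁ m)

≼-contract : ∀ Γ₁ {Γ₂ xs A} → xs ≼ Γ₁ ++ A ∷ A ∷ Γ₂ → xs ≼ Γ₁ ++ A ∷ Γ₂
≼-contract []       []       = []
≼-contract []       (use m)  = use (≼-contract [] m)
≼-contract []       (skip m) = m
≼-contract (_ ∷ Γ₁) []       = []
≼-contract (_ ∷ Γ₁) (use m)  = use (≼-contract (_ ∷ Γ₁) m)
≼-contract (_ ∷ Γ₁) (skip m) = skip (≼-contract Γ₁ m)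

≼-weaken : ∀ Γ₁ {Γ₂ xs A} → xs ≼ Γ₁ ++ Γ₂ → xs ≼ Γ₁ ++ A ∷ Γ₂
≼-weaken []       m        = skip m
≼-weaken (_ ∷ Γ₁) []       = []
≼-weaken (_ ∷ Γ₁) (use m)  = use (≼-weaken (_ ∷ Γ₁) m)
≼-weaken (_ ∷ Γ₁) (skip m) = skip (≼-weaken Γ₁ m)

module _ {P : Fm → Set} where

  All-middle : ∀ Γ₁ {Γ₂ A} → All P (Γ₁ ++ A ∷ Γ₂) → P A
  All-middle Γ₁ ps = head (++⁻ʳ Γ₁ ps)

  All-replace : ∀ Γ₁ {Γ₂ A B} → (P A → P B) → All P (Γ₁ ++ A ∷ Γ₂) → All P (Γ₁ ++ B ∷ Γ₂)
  All-replace Γ₁ f ps with ++⁻ Γ₁ ps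
  ... | ps₁ , pA ∷ ps₂ = ++⁺ ps₁ (f pA ∷ ps₂)

  All-duplicate : ∀ Γ₁ {Γ₂ A} → All P (Γ₁ ++ A ∷ Γ₂) → All P (Γ₁ ++ A ∷ A ∷ Γ₂)
  All-duplicate Γ₁ ps with ++⁻ Γ₁ ps
  ... | ps₁ , pA ∷ ps₂ = ++⁺ ps₁ (pA ∷ pA ∷ ps₂)

  All-delete : ∀ Γ₁ {Γ₂ A} → All P (Γ₁ ++ A ∷ Γ₂) → All P (Γ₁ ++ Γ₂)
  All-delete Γ₁ ps with ++⁻ Γ₁ ps
  ... | ps₁ , _ ∷ ps₂ = ++⁺ ps₁ ps₂

cutFree⇒yield≼ : ∀ {w Γ C} → Γ ⊢[ w , false ] C → All Atomic Γ → Positive C → yield C ≼ Γ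
cutFree⇒yield≼ {C = C} ax (a ∷ []) _ rewrite yield-atomic C a = use []
cutFree⇒yield≼ (·L {Γ₁ = Γ₁} _) as _ with All-middle Γ₁ as
... | _ , ()
cutFree⇒yield≼ (·R {Γ₁ = Γ₁} d e) as (c · c′) =
  ≼-++ (cutFree⇒yield≼ d (++⁻ˡ Γ₁ as) c) (cutFree⇒yield≼ e (++⁻ʳ Γ₁ as) c′)
cutFree⇒yield≼ (\\L {Π = Π} {Γ₁ = Γ₁} _ _) as _ with All-middle Π (++⁻ʳ Γ₁ as)
... | _ , ()
cutFree⇒yield≼ (\\R _) _ ()
cutFree⇒yield≼ (//L {Γ₁ = Γ₁} _ _) as _ with All-middle Γ₁ as
... | _ , ()
cutFree⇒yield≼ (//R _) _ ()
cutFree⇒yield≼ (!L {Γ₁ = Γ₁} d) as c =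
  ≼-unbang Γ₁ (cutFree⇒yield≼ d (All-replace Γ₁ (λ a → a) as) c)
cutFree⇒yield≼ (!R d) as (! c) = cutFree⇒yield≼ d as c
cutFree⇒yield≼ (contr {Γ₁ = Γ₁} d) as c =
  ≼-contract Γ₁ (cutFree⇒yield≼ d (All-duplicate Γ₁ as) c)
cutFree⇒yield≼ (weak {Γ₁ = Γ₁} _ d) as c =
  ≼-weaken Γ₁ (cutFree⇒yield≼ d (All-delete Γ₁ as) c)
cutFree⇒yield≼ (cut () _ _)

p q : Fm
p = var 0
q = var 1

pair : Fm
pair = ! p · ! q

pqpq⋠pq : ¬ (p ∷ q ∷ p ∷ q ∷ [] ≼ ! p ∷ ! q ∷ [])
pqpq⋠pq (use (skip (use (skip ()))))
pqpq⋠pq (use (skip (skip ())))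
pqpq⋠pq (skip (skip ()))

pair·pair-by-cut : ∀ {w} → (! p ∷ ! q ∷ []) ⊢[ w , true ] pair · pair
pair·pair-by-cut = cut {Γ₁ = []} {Γ₂ = []} refl
  (!R {As = p ∷ q ∷ []} (·R {Γ₁ = ! p ∷ []} ax ax))
  (contr {Γ₁ = []} {Γ₂ = []}
    (·R {Γ₁ = ! pair ∷ []} (!L {Γ₁ = []} {Γ₂ = []} ax) (!L {Γ₁ = []} {Γ₂ = []} ax)))

theorem3 : (w : Bool) → Σ (List Fm) λ Γ → Σ Fm λ C →
    (Γ ⊢[ w , true ] C) × ¬ (Γ ⊢[ w , false ] C)
theorem3 w = ! p ∷ ! q ∷ [] , pair · pair , pair·pair-by-cut , λ d →
  pqpq⋠pq (cutFree⇒yield≼ d ((0 , refl) ∷ (1 , refl) ∷ []) (positive-pair · positive-pair))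
  where
  positive-pair : Positive pair
  positive-pair = (! var) · (! var)
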